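{- Let $X=\{X_1,X_2\}$ be a $\lambda_2$-equitable $2$-partition of $J(n,3)$ with quotient matrix $(p_{ij})$ satisfying $p_{11}\geq p_{22}$ and $p_{11}\geq 2n-7$, and assume no vertex is of type (I) or (II). Let $\{a,b,c\}$ be a vertex with $\overline{abc}=1$ and suppose there are distinct $d,e\in[n]\setminus\{a,b,c\}$ with $(\overline{abd},\overline{acd},\overline{bcd})=(1,1,0)$, $(\overline{abe},\overline{ace},\overline{bce})=(0,0,1)$, and for every $f\in[n]\setminus\{a,b,c,d,e\}$ the triple $(\overline{abf},\overline{acf},\overline{bcf})$ is $(1,1,1)$ or $(0,0,0)$. Then $n\leq 14$.
   Context: $J(n,3)$: vertices are the $3$-subsets of $[n]$, adjacent iff they share exactly two elements; it is $3(n-3)$-regular. An equitable $2$-partition with quotient matrix $(p_{ij})$ means each vertex of $X_i$ has exactly $p_{ij}$ neighbours in $X_j$; $\lambda_2$-equitable means $p_{11}-p_{21}=n-7$. $\overline{u}=1$ if $u\in X_1$, else $0$; $\overline{xyz}=\overline{\{x,y,z\}}$; $\overline{ij\ast}$ is the number of $3$-subsets containing $i,j$ lying in $X_1$. A vertex $v=\{x,y,z\}\in X_1$, labelled so that $\overline{xy\ast}\geq\overline{xz\ast}\geq\overline{yz\ast}$, is of type (I) if $(\overline{xy\ast}-\overline{xz\ast},\overline{xz\ast}-\overline{yz\ast})=(n-4,0)$ and of type (II) if this pair equals $((n-4)/2,(n-4)/2)$. -}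

module Defs where

open import Data.Bool using (Bool; true; false)
open import Data.Nat using (ℕ; zero; suc; _+_; _*_; _≤_)
import Data.Nat.Properties as ℕP
open import Data.Fin using (Fin)
open import Data.Fin.Subset using (Subset; ⁅_⁆; _∪_; _∩_; ∣_∣; _∈_; _∉_)
open import Data.Fin.Subset.Properties using (_∈?_)
open import Data.Vec using ([]; _∷_)
open import Data.List using (List; [_]; map; _++_; filter; length)
open import Data.Product using (Σ; ∃; _×_; _,_)
open import Relation.Nullary using (¬_)
open import Relation.Nullary.Decidable using (_×-dec_)
open import Relation.Binary.PropositionalEquality using (_≡_; _≢_)
open import Relation.Unary using (Pred; Decidable)
import Data.Bool.Properties as BP

allSubsets : (n : ℕ) → List (Subset n)
allSubsets zero = [ [] ]
allSubsets (suc n) = map (true ∷_) (allSubsets n) ++ map (false ∷_) (allSubsets n)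

-- A 2-partition {X₁, X₂} of the vertex set of J(n,3) is given by its
-- indicator χ : Subset n → Bool  (X₁ = {v : |v| = 3, χ v = true},
-- X₂ = {v : |v| = 3, χ v = false}); values on non-3-subsets are irrelevant.
Colouring : ℕ → Set
Colouring n = Subset n → Bool

IsVertex : ∀ {n} → Subset n → Set
IsVertex v = ∣ v ∣ ≡ 3

Adj : ∀ {n} → Subset n → Subset n → Set
Adj v w = ∣ w ∣ ≡ 3 × ∣ v ∩ w ∣ ≡ 2

nbrsIn : ∀ {n} → Colouring n → Bool → Subset n → ℕ
nbrsIn {n} χ b v =
  length (filter (λ w → (∣ w ∣ Data.Nat.≟ 3 ×-dec ∣ v ∩ w ∣ Data.Nat.≟ 2) ×-dec (χ w BP.≟ b))
                 (allSubsets n))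

triple : ∀ {n} → Fin n → Fin n → Fin n → Subset n
triple x y z = ⁅ x ⁆ ∪ ⁅ y ⁆ ∪ ⁅ z ⁆

bar : ∀ {n} → Colouring n → Fin n → Fin n → Fin n → Bool
bar χ x y z = χ (triple x y z)

pairCount : ∀ {n} → Colouring n → Fin n → Fin n → ℕ
pairCount {n} χ i j =
  length (filter (λ w → ((∣ w ∣ Data.Nat.≟ 3 ×-dec i ∈? w) ×-dec j ∈? w) ×-dec (χ w BP.≟ true))
                 (allSubsets n))

IsEquitable2Partition : ∀ {n} → Colouring n → ℕ → ℕ → ℕ → ℕ → Set
IsEquitable2Partition χ p₁₁ p₁₂ p₂₁ p₂₂ =
  (∃ λ v → IsVertex v × χ v ≡ true) ×
  (∃ λ v → IsVertex v × χ v ≡ false) ×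
  (∀ v → IsVertex v → χ v ≡ true → nbrsIn χ true v ≡ p₁₁ × nbrsIn χ false v ≡ p₁₂) ×
  (∀ v → IsVertex v → χ v ≡ false → nbrsIn χ true v ≡ p₂₁ × nbrsIn χ false v ≡ p₂₂)

-- λ₂-equitable: p₁₁ - p₂₁ = n - 7 (stated over ℕ as p₁₁ + 7 = p₂₁ + n)
IsLambda2 : ℕ → ℕ → ℕ → Set
IsLambda2 n p₁₁ p₂₁ = p₁₁ + 7 ≡ p₂₁ + n

Labelling : ∀ {n} → Colouring n → Subset n → Fin n → Fin n → Fin n → Set
Labelling χ v x y z =
  x ≢ y × x ≢ z × y ≢ z × v ≡ triple x y z ×
  pairCount χ x z ≤ pairCount χ x y × pairCount χ y z ≤ pairCount χ x z

-- type (I): (xy* - xz*, xz* - yz*) = (n-4, 0)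
TypeI : ∀ {n} → Colouring n → Subset n → Set
TypeI {n} χ v = ∃ λ x → ∃ λ y → ∃ λ z → Labelling χ v x y z ×
  pairCount χ x y + 4 ≡ pairCount χ x z + n ×
  pairCount χ x z ≡ pairCount χ y z

-- type (II): (xy* - xz*, xz* - yz*) = ((n-4)/2, (n-4)/2)
TypeII : ∀ {n} → Colouring n → Subset n → Set
TypeII {n} χ v = ∃ λ x → ∃ λ y → ∃ λ z → Labelling χ v x y z ×
  2 * pairCount χ x y + 4 ≡ 2 * pairCount χ x z + n ×
  pairCount χ x y + pairCount χ y z ≡ 2 * pairCount χ x z

-- Double counting the X₁-neighbours of a vertex {x,y,z} gives p₁₁ + 3 = xy* + xz* + yz* when
-- {x,y,z} ∈ X₁ and p₂₁ = xy* + xz* + yz* otherwise.  Writing xy* as the number of t with xyt ∈ X₁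
-- and comparing term by term, the hypotheses on the points f give ab* = ac* = bc* (for ab* and bc*
-- the discrepancies at d and e cancel).  The equations of the six triples abd, acd, bcd, abe, ace,
-- bce together with p₁₁ + 7 = p₂₁ + n then give 2·ad* + 12 = 2·ae* + 3n, and since ad* ≤ n − 2
-- this forces n ≤ 8.
module Submission where

open import Defs
import Data.Nat.Properties as ℕ
open import Algebra.Properties.CommutativeMonoid.Sum ℕ.+-0-commutativeMonoid
  using (sum; sum-syntax; ∑-distrib-+; sum-cong-≗; sum-replicate-zero)
open import Algebra.Properties.CommutativeSemigroup ℕ.+-commutativeSemigroup using (interchange)
open import Data.Bool using (Bool; true; false; _∧_; _∨_; if_then_else_)
open import Data.Bool.Properties using (∧-zeroʳ; ∧-identityʳ; ∨-zeroʳ; ¬-not) renaming (_≟_ to _≟ᵇ_)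
open import Data.Empty using (⊥-elim)
open import Data.Fin using (Fin; zero; suc; _≟_)
open import Data.Fin.Subset using (Subset; ⁅_⁆; _∪_; _∩_; ∣_∣; ⊥)
open import Data.Fin.Subset.Properties
  using (_∈?_; _⊆?_; x∈⁅x⁆; x≢y⇒x∉⁅y⁆; ∪-assoc; ∪-comm; ∪-identityˡ; ∪-identityʳ; ∣⁅x⁆∣≡1)
open import Data.List as List using ([]; _∷_; map; filter; length; _++_)
open import Data.List.Properties using (filter-++; length-++)
open import Data.Nat using (ℕ; zero; suc; _+_; _*_; _≤_; _≥_; _≡ᵇ_; z≤n)
open import Data.Nat.Properties using (≤-refl; +-identityʳ; +-suc; +-mono-≤; *-distribˡ-+; +-cancelʳ-≡)
open import Data.Nat.Tactic.RingSolver using (solve)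
open import Data.Product using (_×_; _,_; proj₁)
open import Data.Sum using (_⊎_; inj₁; inj₂)
open import Data.Vec using ([]; _∷_; lookup)
open import Data.Vec.Properties using ([]=⇒lookup; lookup⇒[]=; lookup-zipWith; lookup-replicate)
open import Function using (_∘_)
open import Relation.Binary.PropositionalEquality
  using (_≡_; _≢_; ≢-sym; refl; sym; trans; cong; cong₂; _≗_; module ≡-Reasoning)
open import Relation.Nullary using (¬_; does; yes; no)
open import Relation.Unary using (Pred; Decidable)

𝟙 : Bool → ℕ
𝟙 b = if b then 1 else 0

∑-mono-≤ : ∀ {n} {f g : Fin n → ℕ} → (∀ i → f i ≤ g i) → sum f ≤ sum g
∑-mono-≤ {zero}  f≤g = z≤n
∑-mono-≤ {suc n} f≤g = +-mono-≤ (f≤g zero) (∑-mono-≤ (f≤g ∘ suc))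

∑-one : ∀ n → ∑[ i < n ] 1 ≡ n
∑-one zero    = refl
∑-one (suc n) = cong suc (∑-one n)

∑-cancel : ∀ {n} {f g h k : Fin n → ℕ} →
  (∀ i → f i + g i ≡ h i + k i) → sum g ≡ sum k → sum f ≡ sum h
∑-cancel {f = f} {g} {h} {k} pointwise ∑g≡∑k = +-cancelʳ-≡ (sum g) (sum f) (sum h) (begin
  sum f + sum g              ≡⟨ ∑-distrib-+ f g ⟨
  ∑[ i < _ ] (f i + g i)     ≡⟨ sum-cong-≗ pointwise ⟩
  ∑[ i < _ ] (h i + k i)     ≡⟨ ∑-distrib-+ h k ⟩
  sum h + sum k              ≡⟨ cong (sum h +_) ∑g≡∑k ⟨
  sum h + sum g              ∎)
  where open ≡-Reasoning

∑ₛ : ∀ {n} → (Subset n → ℕ) → ℕ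
∑ₛ {zero}  f = f []
∑ₛ {suc n} f = ∑ₛ (f ∘ (true ∷_)) + ∑ₛ (f ∘ (false ∷_))

∑ₛ-cong : ∀ {n} {f g : Subset n → ℕ} → f ≗ g → ∑ₛ f ≡ ∑ₛ g
∑ₛ-cong {zero}  f≗g = f≗g []
∑ₛ-cong {suc n} f≗g = cong₂ _+_ (∑ₛ-cong (f≗g ∘ (true ∷_))) (∑ₛ-cong (f≗g ∘ (false ∷_)))

∑ₛ-zero : ∀ n → ∑ₛ {n} (λ _ → 0) ≡ 0
∑ₛ-zero zero    = refl
∑ₛ-zero (suc n) = cong₂ _+_ (∑ₛ-zero n) (∑ₛ-zero n)

∑ₛ-distrib-+ : ∀ {n} (f g : Subset n → ℕ) → ∑ₛ (λ w → f w + g w) ≡ ∑ₛ f + ∑ₛ g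
∑ₛ-distrib-+ {zero}  f g = refl
∑ₛ-distrib-+ {suc n} f g =
  trans (cong₂ _+_ (∑ₛ-distrib-+ (f ∘ (true ∷_)) (g ∘ (true ∷_))) (∑ₛ-distrib-+ (f ∘ (false ∷_)) (g ∘ (false ∷_))))
        (interchange (∑ₛ (f ∘ (true ∷_))) (∑ₛ (g ∘ (true ∷_))) (∑ₛ (f ∘ (false ∷_))) (∑ₛ (g ∘ (false ∷_))))

∑ₛ-distribˡ-* : ∀ {n} c (f : Subset n → ℕ) → ∑ₛ (λ w → c * f w) ≡ c * ∑ₛ f
∑ₛ-distribˡ-* {zero}  c f = refl
∑ₛ-distribˡ-* {suc n} c f =
  trans (cong₂ _+_ (∑ₛ-distribˡ-* c (f ∘ (true ∷_))) (∑ₛ-distribˡ-* c (f ∘ (false ∷_))))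
        (sym (*-distribˡ-+ c (∑ₛ (f ∘ (true ∷_))) (∑ₛ (f ∘ (false ∷_)))))

length-filter-map : ∀ {A B : Set} {p} {P : Pred B p} (P? : Decidable P) (g : A → B) xs →
  length (filter P? (map g xs)) ≡ length (filter (P? ∘ g) xs)
length-filter-map P? g []       = refl
length-filter-map P? g (x ∷ xs) with does (P? (g x))
... | true  = cong suc (length-filter-map P? g xs)
... | false = length-filter-map P? g xs

length-filter-allSubsets : ∀ {n p} {P : Pred (Subset n) p} (P? : Decidable P) →
  length (filter P? (allSubsets n)) ≡ ∑ₛ (𝟙 ∘ does ∘ P?)
length-filter-allSubsets {zero} P? with does (P? [])
... | true  = refl
... | false = refl
length-filter-allSubsets {suc n} P? = begin
  length (filter P? (map (true ∷_) S ++ map (false ∷_) S))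
    ≡⟨ cong length (filter-++ P? (map (true ∷_) S) _) ⟩
  length (filter P? (map (true ∷_) S) ++ filter P? (map (false ∷_) S))
    ≡⟨ length-++ (filter P? (map (true ∷_) S)) ⟩
  length (filter P? (map (true ∷_) S)) + length (filter P? (map (false ∷_) S))
    ≡⟨ cong₂ _+_ (length-filter-map P? (true ∷_) S) (length-filter-map P? (false ∷_) S) ⟩
  length (filter (P? ∘ (true ∷_)) S) + length (filter (P? ∘ (false ∷_)) S)
    ≡⟨ cong₂ _+_ (length-filter-allSubsets (P? ∘ (true ∷_))) (length-filter-allSubsets (P? ∘ (false ∷_))) ⟩
  ∑ₛ (𝟙 ∘ does ∘ P?) ∎
  where
  open ≡-Reasoning
  S = allSubsets n

does-≟-true : ∀ b → does (b ≟ᵇ true) ≡ b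
does-≟-true true  = refl
does-≟-true false = refl

lookup-⁅x⁆-x : ∀ {n} (x : Fin n) → lookup ⁅ x ⁆ x ≡ true
lookup-⁅x⁆-x x = []=⇒lookup (x∈⁅x⁆ x)

lookup-⁅y⁆-x : ∀ {n} {x y : Fin n} → x ≢ y → lookup ⁅ y ⁆ x ≡ false
lookup-⁅y⁆-x {y = y} x≢y = ¬-not (x≢y⇒x∉⁅y⁆ x≢y ∘ lookup⇒[]= _ ⁅ y ⁆)

lookup-∪ : ∀ {n} (p q : Subset n) i → lookup (p ∪ q) i ≡ (lookup p i ∨ lookup q i)
lookup-∪ p q i = lookup-zipWith _∨_ i p q

does-∈? : ∀ {n} (x : Fin n) (p : Subset n) → does (x ∈? p) ≡ lookup p x
does-∈? zero    (true  ∷ p) = refl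
does-∈? zero    (false ∷ p) = refl
does-∈? (suc x) (_ ∷ p)     = does-∈? x p

does-⊥⊆? : ∀ {n} (p : Subset n) → does (⊥ ⊆? p) ≡ true
does-⊥⊆? []      = refl
does-⊥⊆? (_ ∷ p) = does-⊥⊆? p

does-⁅x⁆⊆? : ∀ {n} (x : Fin n) (p : Subset n) → does (⁅ x ⁆ ⊆? p) ≡ lookup p x
does-⁅x⁆⊆? zero    (true  ∷ p) = does-⊥⊆? p
does-⁅x⁆⊆? zero    (false ∷ p) = refl
does-⁅x⁆⊆? (suc x) (_ ∷ p)     = does-⁅x⁆⊆? x p

does-∪⊆? : ∀ {n} (p q r : Subset n) → does ((p ∪ q) ⊆? r) ≡ does (p ⊆? r) ∧ does (q ⊆? r)
does-∪⊆? []          []          []          = refl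
does-∪⊆? (true  ∷ p) (true  ∷ q) (true  ∷ r) = does-∪⊆? p q r
does-∪⊆? (true  ∷ p) (false ∷ q) (true  ∷ r) = does-∪⊆? p q r
does-∪⊆? (false ∷ p) (true  ∷ q) (true  ∷ r) = does-∪⊆? p q r
does-∪⊆? (false ∷ p) (false ∷ q) (_     ∷ r) = does-∪⊆? p q r
does-∪⊆? (true  ∷ p) (_     ∷ q) (false ∷ r) = refl
does-∪⊆? (false ∷ p) (true  ∷ q) (false ∷ r) = sym (∧-zeroʳ (does (p ⊆? r)))

∣⁅x⁆∪p∣ : ∀ {n} (x : Fin n) (p : Subset n) → lookup p x ≡ false → ∣ ⁅ x ⁆ ∪ p ∣ ≡ suc ∣ p ∣
∣⁅x⁆∪p∣ zero    (false ∷ p) _    = cong (suc ∘ ∣_∣) (∪-identityˡ p)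
∣⁅x⁆∪p∣ (suc x) (true  ∷ p) x∉p = cong suc (∣⁅x⁆∪p∣ x p x∉p)
∣⁅x⁆∪p∣ (suc x) (false ∷ p) x∉p = ∣⁅x⁆∪p∣ x p x∉p

∣⊥∩p∣ : ∀ {n} (p : Subset n) → ∣ ⊥ ∩ p ∣ ≡ 0
∣⊥∩p∣ []      = refl
∣⊥∩p∣ (_ ∷ p) = ∣⊥∩p∣ p

∣⁅x⁆∩p∣ : ∀ {n} (x : Fin n) (p : Subset n) → ∣ ⁅ x ⁆ ∩ p ∣ ≡ 𝟙 (lookup p x)
∣⁅x⁆∩p∣ zero    (true  ∷ p) = cong suc (∣⊥∩p∣ p)
∣⁅x⁆∩p∣ zero    (false ∷ p) = ∣⊥∩p∣ p
∣⁅x⁆∩p∣ (suc x) (_     ∷ p) = ∣⁅x⁆∩p∣ x p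

∣[⁅x⁆∪p]∩q∣ : ∀ {n} (x : Fin n) (p q : Subset n) → lookup p x ≡ false →
  ∣ (⁅ x ⁆ ∪ p) ∩ q ∣ ≡ 𝟙 (lookup q x) + ∣ p ∩ q ∣
∣[⁅x⁆∪p]∩q∣ zero    (false ∷ p) (true  ∷ q) _   = cong (λ r → suc ∣ r ∩ q ∣) (∪-identityˡ p)
∣[⁅x⁆∪p]∩q∣ zero    (false ∷ p) (false ∷ q) _   = cong (λ r → ∣ r ∩ q ∣) (∪-identityˡ p)
∣[⁅x⁆∪p]∩q∣ (suc x) (true  ∷ p) (true  ∷ q) x∉p =
  trans (cong suc (∣[⁅x⁆∪p]∩q∣ x p q x∉p)) (sym (+-suc _ _))
∣[⁅x⁆∪p]∩q∣ (suc x) (true  ∷ p) (false ∷ q) x∉p = ∣[⁅x⁆∪p]∩q∣ x p q x∉p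
∣[⁅x⁆∪p]∩q∣ (suc x) (false ∷ p) (_     ∷ q) x∉p = ∣[⁅x⁆∪p]∩q∣ x p q x∉p

δ : ∀ {n} → Fin n → Fin n → ℕ
δ x t = 𝟙 (lookup ⁅ x ⁆ t)

δ-x : ∀ {n} (x : Fin n) → δ x x ≡ 1
δ-x x = cong 𝟙 (lookup-⁅x⁆-x x)

δ-off : ∀ {n} {x t : Fin n} → t ≢ x → δ x t ≡ 0
δ-off t≢x = cong 𝟙 (lookup-⁅y⁆-x t≢x)

∑-δ : ∀ {n} (x : Fin n) → ∑[ t < n ] δ x t ≡ 1
∑-δ {suc n} zero    =
  cong suc (trans (sum-cong-≗ {n} {𝟙 ∘ lookup ⊥} (λ t → cong 𝟙 (lookup-replicate t false))) (sum-replicate-zero n))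
∑-δ {suc n} (suc x) = ∑-δ x

-- The only superset of s with ∣ s ∣ elements is s itself; the padding m carries the
-- induction through the coordinates outside s.
∑ₛ-⊇-padded : ∀ {n} (s : Subset n) m (k : Subset n → ℕ) →
  ∑ₛ (λ w → if does (s ⊆? w) ∧ (∣ w ∣ + m ≡ᵇ ∣ s ∣) then k w else 0) ≡ (if m ≡ᵇ 0 then k s else 0)
∑ₛ-⊇-padded []          m k = refl
∑ₛ-⊇-padded {suc n} (true ∷ s) m k =
  trans (cong₂ _+_ (∑ₛ-⊇-padded s m (k ∘ (true ∷_))) (∑ₛ-zero n)) (+-identityʳ _)
∑ₛ-⊇-padded (false ∷ s) m k = cong₂ _+_ (begin
    ∑ₛ (λ w → if does (s ⊆? w) ∧ (suc (∣ w ∣ + m) ≡ᵇ ∣ s ∣) then k (true ∷ w) else 0)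
      ≡⟨ ∑ₛ-cong (λ w → cong (λ l → if does (s ⊆? w) ∧ (l ≡ᵇ ∣ s ∣) then k (true ∷ w) else 0)
                             (sym (+-suc ∣ w ∣ m))) ⟩
    ∑ₛ (λ w → if does (s ⊆? w) ∧ (∣ w ∣ + suc m ≡ᵇ ∣ s ∣) then k (true ∷ w) else 0)
      ≡⟨ ∑ₛ-⊇-padded s (suc m) (k ∘ (true ∷_)) ⟩
    0 ∎)
  (∑ₛ-⊇-padded s m (k ∘ (false ∷_)))
  where open ≡-Reasoning

∑ₛ-⊇-self : ∀ {n} (s : Subset n) (k : Subset n → ℕ) →
  ∑ₛ (λ w → if does (s ⊆? w) ∧ (∣ w ∣ + 0 ≡ᵇ ∣ s ∣) then k w else 0) ≡ k s
∑ₛ-⊇-self s = ∑ₛ-⊇-padded s 0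

∑ₛ-⊇-oneMore : ∀ {n} (s : Subset n) (h : Subset n → ℕ) →
  ∑ₛ (λ w → if does (s ⊆? w) ∧ (∣ w ∣ ≡ᵇ suc ∣ s ∣) then h w else 0) ≡
  ∑[ t < n ] (if lookup s t then 0 else h (s ∪ ⁅ t ⁆))
∑ₛ-⊇-oneMore []          h = refl
∑ₛ-⊇-oneMore {suc n} (true ∷ s) h =
  trans (cong₂ _+_ (∑ₛ-⊇-oneMore s (h ∘ (true ∷_))) (∑ₛ-zero n)) (+-identityʳ _)
∑ₛ-⊇-oneMore (false ∷ s) h = cong₂ _+_ (begin
    ∑ₛ (λ w → if does (s ⊆? w) ∧ (∣ w ∣ ≡ᵇ ∣ s ∣) then h (true ∷ w) else 0)
      ≡⟨ ∑ₛ-cong (λ w → cong (λ l → if does (s ⊆? w) ∧ (l ≡ᵇ ∣ s ∣) then h (true ∷ w) else 0)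
                             (sym (+-identityʳ ∣ w ∣))) ⟩
    ∑ₛ (λ w → if does (s ⊆? w) ∧ (∣ w ∣ + 0 ≡ᵇ ∣ s ∣) then h (true ∷ w) else 0)
      ≡⟨ ∑ₛ-⊇-self s (h ∘ (true ∷_)) ⟩
    h (true ∷ s)
      ≡⟨ cong (h ∘ (true ∷_)) (∪-identityʳ s) ⟨
    h (true ∷ (s ∪ ⊥)) ∎)
  (∑ₛ-⊇-oneMore s (h ∘ (false ∷_)))
  where open ≡-Reasoning

lookup-⁅y⁆∪⁅z⁆-x : ∀ {n} {x y z : Fin n} → x ≢ y → x ≢ z → lookup (⁅ y ⁆ ∪ ⁅ z ⁆) x ≡ false
lookup-⁅y⁆∪⁅z⁆-x {x = x} {y} {z} x≢y x≢z =
  trans (lookup-∪ ⁅ y ⁆ ⁅ z ⁆ x) (cong₂ _∨_ (lookup-⁅y⁆-x x≢y) (lookup-⁅y⁆-x x≢z))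

∣⁅x⁆∪⁅y⁆∣ : ∀ {n} {x y : Fin n} → x ≢ y → ∣ ⁅ x ⁆ ∪ ⁅ y ⁆ ∣ ≡ 2
∣⁅x⁆∪⁅y⁆∣ {x = x} {y} x≢y = trans (∣⁅x⁆∪p∣ x ⁅ y ⁆ (lookup-⁅y⁆-x x≢y)) (cong suc (∣⁅x⁆∣≡1 y))

∣triple∣ : ∀ {n} {x y z : Fin n} → x ≢ y → x ≢ z → y ≢ z → ∣ triple x y z ∣ ≡ 3
∣triple∣ {x = x} {y} {z} x≢y x≢z y≢z =
  trans (∣⁅x⁆∪p∣ x (⁅ y ⁆ ∪ ⁅ z ⁆) (lookup-⁅y⁆∪⁅z⁆-x x≢y x≢z)) (cong suc (∣⁅x⁆∪⁅y⁆∣ y≢z))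

∣triple∩p∣ : ∀ {n} {x y z : Fin n} → x ≢ y → x ≢ z → y ≢ z → ∀ p →
  ∣ triple x y z ∩ p ∣ ≡ 𝟙 (lookup p x) + (𝟙 (lookup p y) + 𝟙 (lookup p z))
∣triple∩p∣ {x = x} {y} {z} x≢y x≢z y≢z p = begin
  ∣ (⁅ x ⁆ ∪ ⁅ y ⁆ ∪ ⁅ z ⁆) ∩ p ∣
    ≡⟨ ∣[⁅x⁆∪p]∩q∣ x (⁅ y ⁆ ∪ ⁅ z ⁆) p (lookup-⁅y⁆∪⁅z⁆-x x≢y x≢z) ⟩
  𝟙 (lookup p x) + ∣ (⁅ y ⁆ ∪ ⁅ z ⁆) ∩ p ∣
    ≡⟨ cong (𝟙 (lookup p x) +_) (∣[⁅x⁆∪p]∩q∣ y ⁅ z ⁆ p (lookup-⁅y⁆-x y≢z)) ⟩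
  𝟙 (lookup p x) + (𝟙 (lookup p y) + ∣ ⁅ z ⁆ ∩ p ∣)
    ≡⟨ cong (λ k → 𝟙 (lookup p x) + (𝟙 (lookup p y) + k)) (∣⁅x⁆∩p∣ z p) ⟩
  𝟙 (lookup p x) + (𝟙 (lookup p y) + 𝟙 (lookup p z)) ∎
  where open ≡-Reasoning

does-⁅x⁆∪⁅y⁆⊆? : ∀ {n} (x y : Fin n) p → does ((⁅ x ⁆ ∪ ⁅ y ⁆) ⊆? p) ≡ lookup p x ∧ lookup p y
does-⁅x⁆∪⁅y⁆⊆? x y p = trans (does-∪⊆? ⁅ x ⁆ ⁅ y ⁆ p) (cong₂ _∧_ (does-⁅x⁆⊆? x p) (does-⁅x⁆⊆? y p))

does-triple⊆? : ∀ {n} (x y z : Fin n) p → does (triple x y z ⊆? p) ≡ lookup p x ∧ (lookup p y ∧ lookup p z)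
does-triple⊆? x y z p =
  trans (does-∪⊆? ⁅ x ⁆ (⁅ y ⁆ ∪ ⁅ z ⁆) p) (cong₂ _∧_ (does-⁅x⁆⊆? x p) (does-⁅x⁆∪⁅y⁆⊆? y z p))

triple-swap₂₃ : ∀ {n} (x y z : Fin n) → triple x z y ≡ triple x y z
triple-swap₂₃ x y z = cong (⁅ x ⁆ ∪_) (∪-comm ⁅ z ⁆ ⁅ y ⁆)

triple-rotate : ∀ {n} (x y z : Fin n) → triple y z x ≡ triple x y z
triple-rotate x y z = begin
  ⁅ y ⁆ ∪ (⁅ z ⁆ ∪ ⁅ x ⁆)   ≡⟨ ∪-comm ⁅ y ⁆ _ ⟩
  (⁅ z ⁆ ∪ ⁅ x ⁆) ∪ ⁅ y ⁆   ≡⟨ ∪-assoc ⁅ z ⁆ ⁅ x ⁆ ⁅ y ⁆ ⟩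
  ⁅ z ⁆ ∪ (⁅ x ⁆ ∪ ⁅ y ⁆)   ≡⟨ ∪-comm ⁅ z ⁆ _ ⟩
  (⁅ x ⁆ ∪ ⁅ y ⁆) ∪ ⁅ z ⁆   ≡⟨ ∪-assoc ⁅ x ⁆ ⁅ y ⁆ ⁅ z ⁆ ⟩
  ⁅ x ⁆ ∪ (⁅ y ⁆ ∪ ⁅ z ⁆)   ∎
  where open ≡-Reasoning

pairTerm : ∀ {n} → Colouring n → Fin n → Fin n → Fin n → ℕ
pairTerm χ x y t = if lookup ⁅ x ⁆ t ∨ lookup ⁅ y ⁆ t then 0 else 𝟙 (bar χ x y t)

pairTerm-x : ∀ {n} (χ : Colouring n) (x y : Fin n) → pairTerm χ x y x ≡ 0
pairTerm-x χ x y rewrite lookup-⁅x⁆-x x = refl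

pairTerm-y : ∀ {n} (χ : Colouring n) (x y : Fin n) → pairTerm χ x y y ≡ 0
pairTerm-y χ x y rewrite lookup-⁅x⁆-x y | ∨-zeroʳ (lookup ⁅ x ⁆ y) = refl

pairTerm-off : ∀ {n} (χ : Colouring n) {x y t : Fin n} → t ≢ x → t ≢ y → pairTerm χ x y t ≡ 𝟙 (bar χ x y t)
pairTerm-off χ t≢x t≢y rewrite lookup-⁅y⁆-x t≢x | lookup-⁅y⁆-x t≢y = refl

pairCount≡∑pairTerm : ∀ {n} (χ : Colouring n) {x y : Fin n} → x ≢ y →
  pairCount χ x y ≡ ∑[ t < n ] pairTerm χ x y t
pairCount≡∑pairTerm {n} χ {x} {y} x≢y = begin
  pairCount χ x y
    ≡⟨ length-filter-allSubsets {n} _ ⟩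
  ∑ₛ (λ w → 𝟙 ((((∣ w ∣ ≡ᵇ 3) ∧ does (x ∈? w)) ∧ does (y ∈? w)) ∧ does (χ w ≟ᵇ true)))
    ≡⟨ ∑ₛ-cong pointwise ⟩
  ∑ₛ (λ w → if does (xy ⊆? w) ∧ (∣ w ∣ ≡ᵇ suc ∣ xy ∣) then 𝟙 (χ w) else 0)
    ≡⟨ ∑ₛ-⊇-oneMore xy (𝟙 ∘ χ) ⟩
  ∑[ t < n ] (if lookup xy t then 0 else 𝟙 (χ (xy ∪ ⁅ t ⁆)))
    ≡⟨ sum-cong-≗ (λ t → cong₂ (λ l v → if l then 0 else 𝟙 (χ v)) (lookup-∪ ⁅ x ⁆ ⁅ y ⁆ t) (∪-assoc ⁅ x ⁆ ⁅ y ⁆ ⁅ t ⁆)) ⟩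
  ∑[ t < n ] pairTerm χ x y t ∎
  where
  open ≡-Reasoning
  xy = ⁅ x ⁆ ∪ ⁅ y ⁆
  table : ∀ A X Y D → 𝟙 (((A ∧ X) ∧ Y) ∧ D) ≡ (if (X ∧ Y) ∧ A then 𝟙 D else 0)
  table true  true  true  D = refl
  table true  true  false D = refl
  table true  false Y     D = refl
  table false true  true  D = refl
  table false true  false D = refl
  table false false Y     D = refl
  pointwise : ∀ w → 𝟙 ((((∣ w ∣ ≡ᵇ 3) ∧ does (x ∈? w)) ∧ does (y ∈? w)) ∧ does (χ w ≟ᵇ true))
                  ≡ (if does (xy ⊆? w) ∧ (∣ w ∣ ≡ᵇ suc ∣ xy ∣) then 𝟙 (χ w) else 0)
  pointwise w rewrite does-∈? x w | does-∈? y w | does-≟-true (χ w) | does-⁅x⁆∪⁅y⁆⊆? x y w | ∣⁅x⁆∪⁅y⁆∣ x≢y =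
    table (∣ w ∣ ≡ᵇ 3) (lookup w x) (lookup w y) (χ w)

pairCount+2≤n : ∀ {n} (χ : Colouring n) {x y : Fin n} → x ≢ y → pairCount χ x y + 2 ≤ n
pairCount+2≤n {n} χ {x} {y} x≢y = begin
  pairCount χ x y + 2
    ≡⟨ cong₂ _+_ (pairCount≡∑pairTerm χ x≢y) (sym (cong₂ _+_ (∑-δ x) (∑-δ y))) ⟩
  ∑[ t < n ] pairTerm χ x y t + (∑[ t < n ] δ x t + ∑[ t < n ] δ y t)
    ≡⟨ trans (∑-distrib-+ (pairTerm χ x y) (λ t → δ x t + δ y t))
             (cong (∑[ t < n ] pairTerm χ x y t +_) (∑-distrib-+ (δ x) (δ y))) ⟨
  ∑[ t < n ] (pairTerm χ x y t + (δ x t + δ y t))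
    ≤⟨ ∑-mono-≤ pointwise ⟩
  ∑[ t < n ] 1
    ≡⟨ ∑-one n ⟩
  n ∎
  where
  open ℕ.≤-Reasoning
  pointwise : ∀ t → pairTerm χ x y t + (δ x t + δ y t) ≤ 1
  pointwise t with t ≟ x | t ≟ y
  ... | yes refl | yes refl = ⊥-elim (x≢y refl)
  ... | yes refl | no t≢y rewrite pairTerm-x χ x y | δ-x x | δ-off t≢y = ≤-refl
  ... | no t≢x | yes refl rewrite pairTerm-y χ x y | δ-off t≢x | δ-x y = ≤-refl
  ... | no t≢x | no t≢y rewrite pairTerm-off χ t≢x t≢y | δ-off t≢x | δ-off t≢y | +-identityʳ (𝟙 (bar χ x y t))
    with bar χ x y t
  ...   | true  = ≤-refl
  ...   | false = z≤n

-- A 3-subset adjacent to v contains exactly one of the three pairs of v; v itself contains all three.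
nbrsIn+3≡∑pairCount : ∀ {n} (χ : Colouring n) {x y z : Fin n} → x ≢ y → x ≢ z → y ≢ z →
  nbrsIn χ true (triple x y z) + 3 * 𝟙 (bar χ x y z) ≡ pairCount χ x y + pairCount χ x z + pairCount χ y z
nbrsIn+3≡∑pairCount {n} χ {x} {y} {z} x≢y x≢z y≢z = begin
  nbrsIn χ true v + 3 * 𝟙 (χ v)
    ≡⟨ cong₂ (λ l r → l + 3 * r) (length-filter-allSubsets {n} _) (sym (∑ₛ-⊇-self v (𝟙 ∘ χ))) ⟩
  ∑ₛ adjacentIn + 3 * ∑ₛ equalsV
    ≡⟨ cong (∑ₛ adjacentIn +_) (∑ₛ-distribˡ-* 3 equalsV) ⟨
  ∑ₛ adjacentIn + ∑ₛ (λ w → 3 * equalsV w)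
    ≡⟨ ∑ₛ-distrib-+ adjacentIn (λ w → 3 * equalsV w) ⟨
  ∑ₛ (λ w → adjacentIn w + 3 * equalsV w)
    ≡⟨ ∑ₛ-cong pointwise ⟩
  ∑ₛ (λ w → contains x y w + contains x z w + contains y z w)
    ≡⟨ trans (∑ₛ-distrib-+ _ (contains y z)) (cong (_+ ∑ₛ (contains y z)) (∑ₛ-distrib-+ (contains x y) (contains x z))) ⟩
  ∑ₛ (contains x y) + ∑ₛ (contains x z) + ∑ₛ (contains y z)
    ≡⟨ cong₂ _+_ (cong₂ _+_ (length-filter-allSubsets {n} _) (length-filter-allSubsets {n} _))
                 (length-filter-allSubsets {n} _) ⟨
  pairCount χ x y + pairCount χ x z + pairCount χ y z ∎
  where
  open ≡-Reasoning
  v = triple x y z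
  adjacentIn equalsV : Subset n → ℕ
  adjacentIn w = 𝟙 (((∣ w ∣ ≡ᵇ 3) ∧ (∣ v ∩ w ∣ ≡ᵇ 2)) ∧ does (χ w ≟ᵇ true))
  equalsV w = if does (v ⊆? w) ∧ (∣ w ∣ + 0 ≡ᵇ ∣ v ∣) then 𝟙 (χ w) else 0
  contains : Fin n → Fin n → Subset n → ℕ
  contains i j w = 𝟙 ((((∣ w ∣ ≡ᵇ 3) ∧ does (i ∈? w)) ∧ does (j ∈? w)) ∧ does (χ w ≟ᵇ true))
  table′ : ∀ X Y Z D →
    𝟙 ((𝟙 X + (𝟙 Y + 𝟙 Z) ≡ᵇ 2) ∧ D) + 3 * (if X ∧ (Y ∧ Z) then 𝟙 D else 0)
      ≡ 𝟙 ((X ∧ Y) ∧ D) + 𝟙 ((X ∧ Z) ∧ D) + 𝟙 ((Y ∧ Z) ∧ D)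
  table′ true  true  true  true  = refl
  table′ true  true  true  false = refl
  table′ true  true  false true  = refl
  table′ true  true  false false = refl
  table′ true  false true  true  = refl
  table′ true  false true  false = refl
  table′ false true  true  true  = refl
  table′ false true  true  false = refl
  table′ true  false false D     = refl
  table′ false true  false D     = refl
  table′ false false true  D     = refl
  table′ false false false D     = refl
  table : ∀ A X Y Z D →
    𝟙 ((A ∧ (𝟙 X + (𝟙 Y + 𝟙 Z) ≡ᵇ 2)) ∧ D) + 3 * (if (X ∧ (Y ∧ Z)) ∧ A then 𝟙 D else 0)
      ≡ 𝟙 (((A ∧ X) ∧ Y) ∧ D) + 𝟙 (((A ∧ X) ∧ Z) ∧ D) + 𝟙 (((A ∧ Y) ∧ Z) ∧ D)
  table true  X Y Z D rewrite ∧-identityʳ (X ∧ (Y ∧ Z)) = table′ X Y Z D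
  table false X Y Z D rewrite ∧-zeroʳ (X ∧ (Y ∧ Z))     = refl
  pointwise : ∀ w → adjacentIn w + 3 * equalsV w ≡ contains x y w + contains x z w + contains y z w
  pointwise w rewrite ∣triple∩p∣ x≢y x≢z y≢z w | ∣triple∣ x≢y x≢z y≢z | +-identityʳ ∣ w ∣
                    | does-triple⊆? x y z w | does-∈? x w | does-∈? y w | does-∈? z w | does-≟-true (χ w) =
    table (∣ w ∣ ≡ᵇ 3) (lookup w x) (lookup w y) (lookup w z) (χ w)

module _ {n} {χ : Colouring n} {p₁₁ p₁₂ p₂₁ p₂₂ : ℕ} (equitable : IsEquitable2Partition χ p₁₁ p₁₂ p₂₁ p₂₂)
         {x y z : Fin n} (x≢y : x ≢ y) (x≢z : x ≢ z) (y≢z : y ≢ z) where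

  ∑pairCount-X₁ : bar χ x y z ≡ true → p₁₁ + 3 ≡ pairCount χ x y + pairCount χ x z + pairCount χ y z
  ∑pairCount-X₁ xyz∈X₁ = let (_ , _ , inX₁ , _) = equitable in
    trans (cong₂ (λ k b → k + 3 * 𝟙 b) (sym (proj₁ (inX₁ _ (∣triple∣ x≢y x≢z y≢z) xyz∈X₁))) (sym xyz∈X₁))
          (nbrsIn+3≡∑pairCount χ x≢y x≢z y≢z)

  ∑pairCount-X₂ : bar χ x y z ≡ false → p₂₁ ≡ pairCount χ x y + pairCount χ x z + pairCount χ y z
  ∑pairCount-X₂ xyz∈X₂ = let (_ , _ , _ , inX₂) = equitable in
    trans (sym (+-identityʳ p₂₁))
      (trans (cong₂ (λ k b → k + 3 * 𝟙 b) (sym (proj₁ (inX₂ _ (∣triple∣ x≢y x≢z y≢z) xyz∈X₂))) (sym xyz∈X₂))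
             (nbrsIn+3≡∑pairCount χ x≢y x≢z y≢z))

-- X = ab* = ac* = bc*, ae = ae*, …; the six equations are those of abe, ace, bce, abd, acd, bcd.
2ad+12≡2ae+3n : ∀ {p q X ae be ce ad bd cd n} →
  p + 7 ≡ q + n →
  q ≡ X + ae + be → q ≡ X + ae + ce → p + 3 ≡ X + be + ce →
  p + 3 ≡ X + ad + bd → p + 3 ≡ X + ad + cd → q ≡ X + bd + cd →
  2 * ad + 12 ≡ 2 * ae + 3 * n
2ad+12≡2ae+3n {p} {q} {X} {ae} {be} {ce} {ad} {bd} {cd} {n} λ₂ abe ace bce abd acd bcd =
  +-cancelʳ-≡ _ (2 * ad + 12) (2 * ae + 3 * n) (trans lhs (trans combined rhs))
  where
  lhs : 2 * ad + 12 + (3 * q + 3 * p + 9 + 3 * X + be + ce + bd + cd)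
      ≡ q + q + q + 3 * (p + 7) + (X + be + ce) + (X + ad + bd) + (X + ad + cd)
  lhs = solve (q List.∷ p List.∷ X List.∷ be List.∷ ce List.∷ ad List.∷ bd List.∷ cd List.∷ List.[])
  combined : q + q + q + 3 * (p + 7) + (X + be + ce) + (X + ad + bd) + (X + ad + cd)
           ≡ (X + ae + be) + (X + ae + ce) + (X + bd + cd) + 3 * (q + n) + (p + 3) + (p + 3) + (p + 3)
  combined = cong₂ _+_ (cong₂ _+_ (cong₂ _+_ (cong₂ _+_ (cong₂ _+_ (cong₂ _+_ abe ace) bcd) (cong (3 *_) λ₂))
                                    (sym bce)) (sym abd)) (sym acd)
  rhs : (X + ae + be) + (X + ae + ce) + (X + bd + cd) + 3 * (q + n) + (p + 3) + (p + 3) + (p + 3)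
      ≡ 2 * ae + 3 * n + (3 * q + 3 * p + 9 + 3 * X + be + ce + bd + cd)
  rhs = solve (q List.∷ p List.∷ X List.∷ ae List.∷ be List.∷ ce List.∷ bd List.∷ cd List.∷ n List.∷ List.[])

2ad+12≡2ae+3n⇒n≤8 : ∀ {ad ae n} → 2 * ad + 12 ≡ 2 * ae + 3 * n → ad + 2 ≤ n → n ≤ 8
2ad+12≡2ae+3n⇒n≤8 {ad} {ae} {n} balance ad+2≤n = ℕ.+-cancelʳ-≤ (2 * n) n 8 (begin
  n + 2 * n          ≡⟨ solve (n List.∷ List.[]) ⟩
  3 * n              ≤⟨ ℕ.m≤n+m (3 * n) (2 * ae) ⟩
  2 * ae + 3 * n     ≡⟨ balance ⟨
  2 * ad + 12        ≡⟨ solve (ad List.∷ List.[]) ⟩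
  2 * (ad + 2) + 8   ≤⟨ ℕ.+-monoˡ-≤ 8 (ℕ.*-monoʳ-≤ 2 ad+2≤n) ⟩
  2 * n + 8          ≡⟨ ℕ.+-comm (2 * n) 8 ⟩
  8 + 2 * n          ∎)
  where open ℕ.≤-Reasoning

module Configuration {n} (χ : Colouring n) {a b c d e : Fin n}
  (a≢b : a ≢ b) (a≢c : a ≢ c) (b≢c : b ≢ c)
  (d≢a : d ≢ a) (d≢b : d ≢ b) (d≢c : d ≢ c) (e≢a : e ≢ a) (e≢b : e ≢ b) (e≢c : e ≢ c) (d≢e : d ≢ e)
  (abc∈X₁ : bar χ a b c ≡ true)
  (abd∈X₁ : bar χ a b d ≡ true) (acd∈X₁ : bar χ a c d ≡ true) (bcd∈X₂ : bar χ b c d ≡ false)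
  (abe∈X₂ : bar χ a b e ≡ false) (ace∈X₂ : bar χ a c e ≡ false) (bce∈X₁ : bar χ b c e ≡ true)
  (others : ∀ f → f ≢ a → f ≢ b → f ≢ c → f ≢ d → f ≢ e →
    (bar χ a b f ≡ true × bar χ a c f ≡ true × bar χ b c f ≡ true) ⊎
    (bar χ a b f ≡ false × bar χ a c f ≡ false × bar χ b c f ≡ false))
  where

  private
    P = pairCount χ

    acb∈X₁ : bar χ a c b ≡ true
    acb∈X₁ = trans (cong χ (triple-swap₂₃ a b c)) abc∈X₁

    bca∈X₁ : bar χ b c a ≡ true
    bca∈X₁ = trans (cong χ (triple-rotate a b c)) abc∈X₁

    ab≡ac-elsewhere : ∀ {t} → t ≢ a → t ≢ b → t ≢ c → t ≢ d → t ≢ e → bar χ a b t ≡ bar χ a c t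
    ab≡ac-elsewhere t≢a t≢b t≢c t≢d t≢e with others _ t≢a t≢b t≢c t≢d t≢e
    ... | inj₁ (abt , act , _) = trans abt (sym act)
    ... | inj₂ (abt , act , _) = trans abt (sym act)

    ab≡bc-elsewhere : ∀ {t} → t ≢ a → t ≢ b → t ≢ c → t ≢ d → t ≢ e → bar χ a b t ≡ bar χ b c t
    ab≡bc-elsewhere t≢a t≢b t≢c t≢d t≢e with others _ t≢a t≢b t≢c t≢d t≢e
    ... | inj₁ (abt , _ , bct) = trans abt (sym bct)
    ... | inj₂ (abt , _ , bct) = trans abt (sym bct)

  pairCount-ab≡ac : P a b ≡ P a c
  pairCount-ab≡ac = begin
    P a b                        ≡⟨ pairCount≡∑pairTerm χ a≢b ⟩
    ∑[ t < n ] pairTerm χ a b t  ≡⟨ ∑-cancel pointwise (trans (∑-δ b) (sym (∑-δ c))) ⟩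
    ∑[ t < n ] pairTerm χ a c t  ≡⟨ pairCount≡∑pairTerm χ a≢c ⟨
    P a c                        ∎
    where
    open ≡-Reasoning
    pointwise : ∀ t → pairTerm χ a b t + δ b t ≡ pairTerm χ a c t + δ c t
    pointwise t with t ≟ a
    ... | yes refl rewrite pairTerm-x χ a b | pairTerm-x χ a c | δ-off a≢b | δ-off a≢c = refl
    ... | no t≢a with t ≟ b
    ... | yes refl rewrite pairTerm-y χ a b | δ-x b | pairTerm-off χ t≢a b≢c | δ-off b≢c | acb∈X₁ = refl
    ... | no t≢b with t ≟ c
    ... | yes refl rewrite pairTerm-off χ t≢a t≢b | δ-off t≢b | pairTerm-y χ a c | δ-x c | abc∈X₁ = refl
    ... | no t≢c rewrite pairTerm-off χ t≢a t≢b | pairTerm-off χ t≢a t≢c | δ-off t≢b | δ-off t≢c with t ≟ d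
    ... | yes refl rewrite abd∈X₁ | acd∈X₁ = refl
    ... | no t≢d with t ≟ e
    ... | yes refl rewrite abe∈X₂ | ace∈X₂ = refl
    ... | no t≢e rewrite ab≡ac-elsewhere t≢a t≢b t≢c t≢d t≢e = refl

  pairCount-ab≡bc : P a b ≡ P b c
  pairCount-ab≡bc = begin
    P a b                        ≡⟨ pairCount≡∑pairTerm χ a≢b ⟩
    ∑[ t < n ] pairTerm χ a b t  ≡⟨ ∑-cancel pointwise (trans (∑-δ+δ a e) (sym (∑-δ+δ c d))) ⟩
    ∑[ t < n ] pairTerm χ b c t  ≡⟨ pairCount≡∑pairTerm χ b≢c ⟨
    P b c                        ∎
    where
    open ≡-Reasoning
    ∑-δ+δ : ∀ x y → ∑[ t < n ] (δ x t + δ y t) ≡ 2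
    ∑-δ+δ x y = trans (∑-distrib-+ (δ x) (δ y)) (cong₂ _+_ (∑-δ x) (∑-δ y))
    pointwise : ∀ t → pairTerm χ a b t + (δ a t + δ e t) ≡ pairTerm χ b c t + (δ c t + δ d t)
    pointwise t with t ≟ a
    ... | yes refl rewrite pairTerm-x χ a b | δ-x a | δ-off (≢-sym e≢a) | pairTerm-off χ a≢b a≢c
                         | δ-off a≢c | δ-off (≢-sym d≢a) | bca∈X₁ = refl
    ... | no t≢a with t ≟ b
    ... | yes refl rewrite pairTerm-y χ a b | δ-off t≢a | δ-off (≢-sym e≢b) | pairTerm-x χ b c
                         | δ-off b≢c | δ-off (≢-sym d≢b) = refl
    ... | no t≢b with t ≟ c
    ... | yes refl rewrite pairTerm-off χ t≢a t≢b | δ-off t≢a | δ-off (≢-sym e≢c) | pairTerm-y χ b c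
                         | δ-x c | δ-off (≢-sym d≢c) | abc∈X₁ = refl
    ... | no t≢c rewrite pairTerm-off χ t≢a t≢b | pairTerm-off χ t≢b t≢c | δ-off t≢a | δ-off t≢c with t ≟ d
    ... | yes refl rewrite δ-off d≢e | δ-x d | abd∈X₁ | bcd∈X₂ = refl
    ... | no t≢d with t ≟ e
    ... | yes refl rewrite δ-x e | δ-off t≢d | abe∈X₂ | bce∈X₁ = refl
    ... | no t≢e rewrite δ-off t≢d | δ-off t≢e | ab≡bc-elsewhere t≢a t≢b t≢c t≢d t≢e = refl

  n≤8 : ∀ {p₁₁ p₁₂ p₂₁ p₂₂} → IsEquitable2Partition χ p₁₁ p₁₂ p₂₁ p₂₂ → IsLambda2 n p₁₁ p₂₁ → n ≤ 8
  n≤8 equitable λ₂ = 2ad+12≡2ae+3n⇒n≤8 {ae = P a e}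
    (2ad+12≡2ae+3n {X = P a b} {P a e} {P b e} {P c e} {P a d} {P b d} {P c d} λ₂
      (∑pairCount-X₂ equitable a≢b a≢e b≢e abe∈X₂)
      (via pairCount-ab≡ac (∑pairCount-X₂ equitable a≢c a≢e c≢e ace∈X₂))
      (via pairCount-ab≡bc (∑pairCount-X₁ equitable b≢c b≢e c≢e bce∈X₁))
      (∑pairCount-X₁ equitable a≢b a≢d b≢d abd∈X₁)
      (via pairCount-ab≡ac (∑pairCount-X₁ equitable a≢c a≢d c≢d acd∈X₁))
      (via pairCount-ab≡bc (∑pairCount-X₂ equitable b≢c b≢d c≢d bcd∈X₂)))
    (pairCount+2≤n χ a≢d)
    where
    a≢d = ≢-sym d≢a ; b≢d = ≢-sym d≢b ; c≢d = ≢-sym d≢c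
    a≢e = ≢-sym e≢a ; b≢e = ≢-sym e≢b ; c≢e = ≢-sym e≢c
    via : ∀ {k u r s} → P a b ≡ u → k ≡ u + r + s → k ≡ P a b + r + s
    via {r = r} {s} ab≡u k≡ = trans k≡ (cong (λ m → m + r + s) (sym ab≡u))

mainTheorem18 : (n : ℕ) (χ : Colouring n) (p₁₁ p₁₂ p₂₁ p₂₂ : ℕ) →
    IsEquitable2Partition χ p₁₁ p₁₂ p₂₁ p₂₂ →
    IsLambda2 n p₁₁ p₂₁ →
    p₁₁ ≥ p₂₂ →
    p₁₁ + 7 ≥ 2 * n →
    (∀ v → IsVertex v → χ v ≡ true → ¬ TypeI χ v × ¬ TypeII χ v) →
    (a b c d e : Fin n) →
    a ≢ b → a ≢ c → b ≢ c →
    d ≢ a → d ≢ b → d ≢ c → e ≢ a → e ≢ b → e ≢ c → d ≢ e →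
    bar χ a b c ≡ true →
    bar χ a b d ≡ true → bar χ a c d ≡ true → bar χ b c d ≡ false →
    bar χ a b e ≡ false → bar χ a c e ≡ false → bar χ b c e ≡ true →
    (∀ f → f ≢ a → f ≢ b → f ≢ c → f ≢ d → f ≢ e →
      (bar χ a b f ≡ true × bar χ a c f ≡ true × bar χ b c f ≡ true) ⊎
      (bar χ a b f ≡ false × bar χ a c f ≡ false × bar χ b c f ≡ false)) →
    n ≤ 14
mainTheorem18 n χ p₁₁ p₁₂ p₂₁ p₂₂ equitable λ₂ _ _ _ a b c d e
  a≢b a≢c b≢c d≢a d≢b d≢c e≢a e≢b e≢c d≢e abc abd acd bcd abe ace bce others =
  ℕ.≤-trans (Configuration.n≤8 χ a≢b a≢c b≢c d≢a d≢b d≢c e≢a e≢b e≢c d≢e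
                                abc abd acd bcd abe ace bce others equitable λ₂)
            (ℕ.m≤m+n 8 6)
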